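{- Let $V$ be a 2-dimensional vector space over a field $k$. Let $v_1,v_2,v_3\in V$ be nonzero and pairwise noncolinear, and let $\lambda_1,\lambda_2,\lambda_3\in V^*$ be nonzero with $\lambda_i(v_i)=0$ for each $i$. For $i,j\in\{1,2,3\}$ let $c_{i,j}\in\mathrm{L}(V)$ be defined by $c_{i,j}(u)=\lambda_j(u)v_i$. Then for all $a_1,a_2\in\mathrm{L}(V)$, $$a_1a_2=\mathrm{tr}(a_1)\mathrm{tr}(a_2)I+\frac{1}{\lambda_1(v_2)\lambda_2(v_3)\lambda_3(v_1)}\sum_{\sigma\in S_3}\varepsilon(\sigma)\,\mathrm{tr}\big(a_1c_{\sigma(1),\sigma(2)}\big)\,\mathrm{tr}\big(a_2c_{\sigma(2),\sigma(3)}\big)\,c_{\sigma(3),\sigma(1)}.$$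
   Context: $\mathrm{L}(V)$ is the space of linear maps $V\to V$, $I$ the identity, juxtaposition is composition, and $\varepsilon(\sigma)$ is the signature of $\sigma\in S_3$. (Under these hypotheses the denominator is nonzero.) -}

module Defs where

open import Level using (Level; _⊔_; suc)
open import Data.Fin using (Fin) renaming (zero to fz; suc to fs)
open import Data.Product using (Σ; _×_; _,_; ∃)
open import Data.List using (List; []; _∷_; foldr)
open import Relation.Nullary using (¬_)
open import Algebra.Bundles using (CommutativeRing)

record Field (c ℓ : Level) : Set (Level.suc (c ⊔ ℓ)) where
  field
    commutativeRing : CommutativeRing c ℓ
  open CommutativeRing commutativeRing public
  field
    1≉0     : ¬ (1# ≈ 0#)
    inverse : ∀ x → ¬ (x ≈ 0#) → Σ Carrier λ y → x * y ≈ 1#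

-- Linear algebra on the 2-dimensional space V = k² (coordinates w.r.t. a basis).
module LinAlg2 {c ℓ} (F : Field c ℓ) where
  open Field F

  Vec2 : Set c
  Vec2 = Fin 2 → Carrier

  -- linear forms V → k (elements of V*), given by their coefficients:
  -- λ(u) = λ₀ u₀ + λ₁ u₁
  Dual2 : Set c
  Dual2 = Fin 2 → Carrier

  -- linear maps V → V, as 2×2 matrices (row, column)
  L : Set c
  L = Fin 2 → Fin 2 → Carrier

  _≈V_ : Vec2 → Vec2 → Set ℓ
  u ≈V w = ∀ i → u i ≈ w i

  _≈L_ : L → L → Set ℓ
  a ≈L b = ∀ i j → a i j ≈ b i j

  zeroV : Vec2
  zeroV _ = 0#

  zeroD : Dual2
  zeroD _ = 0#

  ev : Dual2 → Vec2 → Carrier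
  ev l u = l fz * u fz + l (fs fz) * u (fs fz)

  Colinear : Vec2 → Vec2 → Set (c ⊔ ℓ)
  Colinear u w = Σ Carrier λ a → Σ Carrier λ b →
    ¬ (a ≈ 0# × b ≈ 0#) × ((λ i → a * u i + b * w i) ≈V zeroV)

  -- composition (juxtaposition) of linear maps: (a ∘ b)(u) = a (b u)
  _∘L_ : L → L → L
  (a ∘L b) i j = a i fz * b fz j + a i (fs fz) * b (fs fz) j

  tr : L → Carrier
  tr a = a fz fz + a (fs fz) (fs fz)

  idL : L
  idL fz fz = 1#
  idL fz (fs fz) = 0#
  idL (fs fz) fz = 0#
  idL (fs fz) (fs fz) = 1#

  infixl 6 _+L_
  infixl 7 _·L_ _∘L_
  infix 4 _≈L_ _≈V_

  _+L_ : L → L → L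
  (a +L b) i j = a i j + b i j

  _·L_ : Carrier → L → L
  (x ·L a) i j = x * a i j

  zeroL : L
  zeroL _ _ = 0#

  -- c_{i,j}(u) = λ_j(u) v_i : the matrix (r,s) ↦ v_i(r) λ_j(s)
  cmap : (Fin 3 → Vec2) → (Fin 3 → Dual2) → Fin 3 → Fin 3 → L
  cmap v lam i j r s = v i r * lam j s

data Sign : Set where
  plus minus : Sign

-- The symmetric group S₃, listed explicitly as triples (σ(1), σ(2), σ(3))
-- (indices 1,2,3 represented by Fin 3 elements 0,1,2) together with ε(σ).
record Perm3 : Set where
  constructor perm
  field
    s1 s2 s3 : Fin 3
    sgn      : Sign

f0 f1 f2 : Fin 3
f0 = fz
f1 = fs fz
f2 = fs (fs fz)

S3 : List Perm3
S3 = perm f0 f1 f2 plus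
   ∷ perm f1 f2 f0 plus
   ∷ perm f2 f0 f1 plus
   ∷ perm f1 f0 f2 minus
   ∷ perm f0 f2 f1 minus
   ∷ perm f2 f1 f0 minus
   ∷ []

module Sum3 {c ℓ} (F : Field c ℓ) where
  open Field F
  open LinAlg2 F

  ε : Sign → Carrier
  ε plus = 1#
  ε minus = - 1#

  sumS3 : (Perm3 → L) → L
  sumS3 f = foldr (λ σ acc → f σ +L acc) zeroL S3

{-# OPTIONS --safe #-}
-- Write c_ij = v_i ⊗ λ_j and N_i = c_ii. Rank-one calculus gives
-- tr(a₁ c_ij) tr(a₂ c_jk) c_ki = N_k a₂ N_j a₁ N_i and tr(N₁N₂N₃) = λ₁(v₂)λ₂(v₃)λ₃(v₁),
-- so the sum is Σ_σ ε(σ) N_σ3 a₂ N_σ2 a₁ N_σ1 and the denominator is tr(N₁N₂N₃).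
-- The hypothesis λ_i(v_i) = 0 says exactly that the N_i are traceless. On the
-- three-dimensional space of traceless 2×2 matrices both expressions are alternating
-- trilinear in (N₁, N₂, N₃) (for the trace because N₁N₂ + N₂N₁ = tr(N₁N₂) I there),
-- hence proportional, and comparing them gives
--   Σ_σ ε(σ) N_σ3 a₂ N_σ2 a₁ N_σ1 = tr(N₁N₂N₃) (a₁a₂ − tr a₁ tr a₂ I)
-- for all traceless N_i.
module Submission where

open import Defs
open import Algebra.Bundles using (CommutativeRing)
open import Data.Fin using (Fin; #_) renaming (zero to fz; suc to fs)
open import Data.List using ([]; _∷_; foldr)
open import Data.Nat using (ℕ)
open import Data.Vec using (Vec; lookup; []; _∷_; _++_)
open import Relation.Nullary using (¬_)
open import Relation.Binary.PropositionalEquality using (_≢_)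
import Algebra.Properties.CommutativeSemigroup as CommutativeSemigroupProperties
import Algebra.Properties.Group as GroupProperties
import Algebra.Solver.Ring.NaturalCoefficients.Default as SemiringSolver
import Relation.Binary.Reasoning.Setoid as SetoidReasoning

-- The library's ring solvers must recognise zero coefficients, which is undecidable in an
-- arbitrary commutative ring, and its ℕ-coefficient solver only handles semirings.
-- Writing t = pos t − neg t with negation-free pos t, neg t reduces a ring identity
-- s ≈ t to the semiring identity pos s + neg t ≈ pos t + neg s.
module CommutativeRingSolver {c ℓ} (R : CommutativeRing c ℓ) where
  open CommutativeRing R
  open SemiringSolver commutativeSemiring
    using (Polynomial; con; var; _:+_; _:*_; ⟦_⟧; ⟦_⟧↓; solve; _:=_)
    renaming (prove to proveSemiring)
  open CommutativeSemigroupProperties +-commutativeSemigroup using (interchange)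
  open GroupProperties +-group using (∙-cancelʳ)
  open SetoidReasoning setoid

  infixl 6 _⊕_
  infixl 7 _⊗_
  infix 8 ⊝_

  data Term (n : ℕ) : Set where
    ι       : Fin n → Term n
    𝟘 𝟙     : Term n
    _⊕_ _⊗_ : Term n → Term n → Term n
    ⊝_      : Term n → Term n

  ⟦_⟧ₜ : ∀ {n} → Term n → Vec Carrier n → Carrier
  ⟦ ι i   ⟧ₜ ρ = lookup ρ i
  ⟦ 𝟘     ⟧ₜ ρ = 0#
  ⟦ 𝟙     ⟧ₜ ρ = 1#
  ⟦ s ⊕ t ⟧ₜ ρ = ⟦ s ⟧ₜ ρ + ⟦ t ⟧ₜ ρ
  ⟦ s ⊗ t ⟧ₜ ρ = ⟦ s ⟧ₜ ρ * ⟦ t ⟧ₜ ρ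
  ⟦ ⊝ t   ⟧ₜ ρ = - ⟦ t ⟧ₜ ρ

  pos neg : ∀ {n} → Term n → Polynomial n
  pos (ι i)   = var i
  pos 𝟘       = con 0
  pos 𝟙       = con 1
  pos (s ⊕ t) = pos s :+ pos t
  pos (s ⊗ t) = pos s :* pos t :+ neg s :* neg t
  pos (⊝ t)   = neg t
  neg (ι i)   = con 0
  neg 𝟘       = con 0
  neg 𝟙       = con 0
  neg (s ⊕ t) = neg s :+ neg t
  neg (s ⊗ t) = pos s :* neg t :+ neg s :* pos t
  neg (⊝ t)   = pos t

  ⟦⟧ₜ+neg≈pos : ∀ {n} (t : Term n) ρ → ⟦ t ⟧ₜ ρ + ⟦ neg t ⟧ ρ ≈ ⟦ pos t ⟧ ρ
  ⟦⟧ₜ+neg≈pos (ι i)   ρ = +-identityʳ _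
  ⟦⟧ₜ+neg≈pos 𝟘       ρ = +-identityʳ _
  ⟦⟧ₜ+neg≈pos 𝟙       ρ = +-identityʳ _
  ⟦⟧ₜ+neg≈pos (s ⊕ t) ρ =
    trans (interchange _ _ _ _) (+-cong (⟦⟧ₜ+neg≈pos s ρ) (⟦⟧ₜ+neg≈pos t ρ))
  ⟦⟧ₜ+neg≈pos (s ⊗ t) ρ = begin
      x * y + (⟦ pos s ⟧ ρ * v + u * ⟦ pos t ⟧ ρ)
        ≈⟨ +-congˡ (+-cong (*-congʳ (sym (⟦⟧ₜ+neg≈pos s ρ))) (*-congˡ (sym (⟦⟧ₜ+neg≈pos t ρ)))) ⟩
      x * y + ((x + u) * v + u * (y + v))
        ≈⟨ solve 4 (λ x y u v → x :* y :+ ((x :+ u) :* v :+ u :* (y :+ v))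
                              := (x :+ u) :* (y :+ v) :+ u :* v) refl x y u v ⟩
      (x + u) * (y + v) + u * v
        ≈⟨ +-congʳ (*-cong (⟦⟧ₜ+neg≈pos s ρ) (⟦⟧ₜ+neg≈pos t ρ)) ⟩
      ⟦ pos s ⟧ ρ * ⟦ pos t ⟧ ρ + u * v ∎
    where
    x = ⟦ s ⟧ₜ ρ
    y = ⟦ t ⟧ₜ ρ
    u = ⟦ neg s ⟧ ρ
    v = ⟦ neg t ⟧ ρ
  ⟦⟧ₜ+neg≈pos (⊝ t)   ρ = begin
      - x + ⟦ pos t ⟧ ρ   ≈⟨ +-congˡ (sym (⟦⟧ₜ+neg≈pos t ρ)) ⟩
      - x + (x + u)       ≈⟨ sym (+-assoc _ _ _) ⟩
      - x + x + u         ≈⟨ +-congʳ (-‿inverseˡ x) ⟩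
      0# + u              ≈⟨ +-identityˡ u ⟩
      u                   ∎
    where
    x = ⟦ t ⟧ₜ ρ
    u = ⟦ neg t ⟧ ρ

  NormalFormsAgree : ∀ {n} → Vec Carrier n → Term n → Term n → Set ℓ
  NormalFormsAgree ρ s t = ⟦ pos s :+ neg t ⟧↓ ρ ≈ ⟦ pos t :+ neg s ⟧↓ ρ

  prove : ∀ {n} (ρ : Vec Carrier n) (s t : Term n) →
          NormalFormsAgree ρ s t → ⟦ s ⟧ₜ ρ ≈ ⟦ t ⟧ₜ ρ
  prove ρ s t nf = ∙-cancelʳ (⟦ neg s ⟧ ρ + ⟦ neg t ⟧ ρ) _ _ (begin
      ⟦ s ⟧ₜ ρ + (⟦ neg s ⟧ ρ + ⟦ neg t ⟧ ρ)   ≈⟨ sym (+-assoc _ _ _) ⟩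
      ⟦ s ⟧ₜ ρ + ⟦ neg s ⟧ ρ + ⟦ neg t ⟧ ρ     ≈⟨ +-congʳ (⟦⟧ₜ+neg≈pos s ρ) ⟩
      ⟦ pos s ⟧ ρ + ⟦ neg t ⟧ ρ               ≈⟨ proveSemiring ρ (pos s :+ neg t) (pos t :+ neg s) nf ⟩
      ⟦ pos t ⟧ ρ + ⟦ neg s ⟧ ρ               ≈⟨ +-congʳ (sym (⟦⟧ₜ+neg≈pos t ρ)) ⟩
      ⟦ t ⟧ₜ ρ + ⟦ neg t ⟧ ρ + ⟦ neg s ⟧ ρ     ≈⟨ +-assoc _ _ _ ⟩
      ⟦ t ⟧ₜ ρ + (⟦ neg t ⟧ ρ + ⟦ neg s ⟧ ρ)   ≈⟨ +-congˡ (+-comm _ _) ⟩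
      ⟦ t ⟧ₜ ρ + (⟦ neg s ⟧ ρ + ⟦ neg t ⟧ ρ)   ∎)

module TwoByTwo {c ℓ} (F : Field c ℓ) where
  open Field F
  open LinAlg2 F
  open Sum3 F
  open CommutativeRingSolver commutativeRing
  open GroupProperties +-group using (inverseʳ-unique)
  open SetoidReasoning setoid

  byEntries : {a b : L} → a fz fz ≈ b fz fz → a fz (fs fz) ≈ b fz (fs fz) →
              a (fs fz) fz ≈ b (fs fz) fz → a (fs fz) (fs fz) ≈ b (fs fz) (fs fz) → a ≈L b
  byEntries e₀₀ e₀₁ e₁₀ e₁₁ fz      fz      = e₀₀
  byEntries e₀₀ e₀₁ e₁₀ e₁₁ fz      (fs fz) = e₀₁
  byEntries e₀₀ e₀₁ e₁₀ e₁₁ (fs fz) fz      = e₁₀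
  byEntries e₀₀ e₀₁ e₁₀ e₁₁ (fs fz) (fs fz) = e₁₁

  ≈L-refl : (a : L) → a ≈L a
  ≈L-refl a i j = refl

  ∘L-cong : {a a′ b b′ : L} → a ≈L a′ → b ≈L b′ → a ∘L b ≈L a′ ∘L b′
  ∘L-cong a≈ b≈ i j = +-cong (*-cong (a≈ i fz) (b≈ fz j)) (*-cong (a≈ i (fs fz)) (b≈ (fs fz) j))

  tr-cong : {a b : L} → a ≈L b → tr a ≈ tr b
  tr-cong a≈b = +-cong (a≈b fz fz) (a≈b (fs fz) (fs fz))

  ·L-congˡ : ∀ x {a b : L} → a ≈L b → x ·L a ≈L x ·L b
  ·L-congˡ x a≈b i j = *-congˡ (a≈b i j)

  sumS3-cong : {f g : Perm3 → L} → (∀ σ → f σ ≈L g σ) → sumS3 f ≈L sumS3 g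
  sumS3-cong {f} {g} f≈g = go S3
    where
    go : ∀ σs → foldr (λ σ acc → f σ +L acc) zeroL σs ≈L foldr (λ σ acc → g σ +L acc) zeroL σs
    go []       i j = refl
    go (σ ∷ σs) i j = +-cong (f≈g σ i j) (go σs i j)

  alternating : (Fin 3 → L) → L → L → L
  alternating N a b = sumS3 λ σ → let open Perm3 σ in
    ε sgn ·L (N s3 ∘L b ∘L N s2 ∘L a ∘L N s1)

  alternating-cong : {N M : Fin 3 → L} → (∀ i → N i ≈L M i) → ∀ a b →
                     alternating N a b ≈L alternating M a b
  alternating-cong N≈M a b = sumS3-cong λ σ → let open Perm3 σ in
    ·L-congˡ (ε sgn) (∘L-cong (∘L-cong (∘L-cong (∘L-cong (N≈M s3) (≈L-refl b)) (N≈M s2)) (≈L-refl a)) (N≈M s1))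

  tracelessForm : L → L
  tracelessForm N fz      fz      = N fz fz
  tracelessForm N fz      (fs fz) = N fz (fs fz)
  tracelessForm N (fs fz) fz      = N (fs fz) fz
  tracelessForm N (fs fz) (fs fz) = - N fz fz

  traceless⇒≈tracelessForm : ∀ N → tr N ≈ 0# → N ≈L tracelessForm N
  traceless⇒≈tracelessForm N trN≈0 = byEntries refl refl refl (inverseʳ-unique _ _ trN≈0)

  -- Counterparts on terms of the matrix operations: ⟦_⟧ₜ computes each of them to the
  -- concrete operation, so `prove` applied to symbolic matrices proves concrete identities.
  module Symbolic {n : ℕ} where
    Lₜ : Set
    Lₜ = Fin 2 → Fin 2 → Term n

    _∘ₜ_ : Lₜ → Lₜ → Lₜ
    (a ∘ₜ b) i j = a i fz ⊗ b fz j ⊕ a i (fs fz) ⊗ b (fs fz) j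

    _+ₜ_ : Lₜ → Lₜ → Lₜ
    (a +ₜ b) i j = a i j ⊕ b i j

    _·ₜ_ : Term n → Lₜ → Lₜ
    (x ·ₜ a) i j = x ⊗ a i j

    infixl 6 _+ₜ_
    infixl 7 _·ₜ_ _∘ₜ_

    trₜ : Lₜ → Term n
    trₜ a = a fz fz ⊕ a (fs fz) (fs fz)

    idₜ : Lₜ
    idₜ fz      fz      = 𝟙
    idₜ fz      (fs fz) = 𝟘
    idₜ (fs fz) fz      = 𝟘
    idₜ (fs fz) (fs fz) = 𝟙

    εₜ : Sign → Term n
    εₜ plus  = 𝟙
    εₜ minus = ⊝ 𝟙

    alternatingₜ : (Fin 3 → Lₜ) → Lₜ → Lₜ → Lₜ
    alternatingₜ N a b = foldr (λ σ acc → term σ +ₜ acc) (λ _ _ → 𝟘) S3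
      where
      term : Perm3 → Lₜ
      term σ = let open Perm3 σ in εₜ sgn ·ₜ (N s3 ∘ₜ b ∘ₜ N s2 ∘ₜ a ∘ₜ N s1)

    evₜ : (Fin 2 → Term n) → (Fin 2 → Term n) → Term n
    evₜ ξ x = ξ fz ⊗ x fz ⊕ ξ (fs fz) ⊗ x (fs fz)

    outerₜ : (Fin 2 → Term n) → (Fin 2 → Term n) → Lₜ
    outerₜ x ξ r s = x r ⊗ ξ s

    vecₜ : (i₀ i₁ : Fin n) → Fin 2 → Term n
    vecₜ i₀ i₁ fz      = ι i₀
    vecₜ i₀ i₁ (fs fz) = ι i₁

    matₜ : (i₀₀ i₀₁ i₁₀ i₁₁ : Fin n) → Lₜ
    matₜ i₀₀ i₀₁ i₁₀ i₁₁ fz      fz      = ι i₀₀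
    matₜ i₀₀ i₀₁ i₁₀ i₁₁ fz      (fs fz) = ι i₀₁
    matₜ i₀₀ i₀₁ i₁₀ i₁₁ (fs fz) fz      = ι i₁₀
    matₜ i₀₀ i₀₁ i₁₀ i₁₁ (fs fz) (fs fz) = ι i₁₁

    tracelessₜ : (i₀₀ i₀₁ i₁₀ : Fin n) → Lₜ
    tracelessₜ i₀₀ i₀₁ i₁₀ fz      fz      = ι i₀₀
    tracelessₜ i₀₀ i₀₁ i₁₀ fz      (fs fz) = ι i₀₁
    tracelessₜ i₀₀ i₀₁ i₁₀ (fs fz) fz      = ι i₁₀
    tracelessₜ i₀₀ i₀₁ i₁₀ (fs fz) (fs fz) = ⊝ ι i₀₀

  components : Vec2 → Vec Carrier 2
  components x = x fz ∷ x (fs fz) ∷ []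

  entries : L → Vec Carrier 4
  entries a = a fz fz ∷ a fz (fs fz) ∷ a (fs fz) fz ∷ a (fs fz) (fs fz) ∷ []

  tracelessEntries : L → Vec Carrier 3
  tracelessEntries a = a fz fz ∷ a fz (fs fz) ∷ a (fs fz) fz ∷ []

  alternating-tracelessForm : (N : Fin 3 → L) (a b : L) →
    alternating (λ i → tracelessForm (N i)) a b
      ≈L tr (tracelessForm (N f0) ∘L tracelessForm (N f1) ∘L tracelessForm (N f2))
         ·L (a ∘L b +L (- (tr a * tr b)) ·L idL)
  alternating-tracelessForm N a b =
    byEntries (at fz fz refl) (at fz (fs fz) refl) (at (fs fz) fz refl) (at (fs fz) (fs fz) refl)
    where
    open Symbolic {17}
    ρ : Vec Carrier 17
    ρ = tracelessEntries (N f0) ++ tracelessEntries (N f1) ++ tracelessEntries (N f2)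
        ++ entries a ++ entries b
    Nₜ : Fin 3 → Lₜ
    Nₜ fz           = tracelessₜ (# 0) (# 1) (# 2)
    Nₜ (fs fz)      = tracelessₜ (# 3) (# 4) (# 5)
    Nₜ (fs (fs fz)) = tracelessₜ (# 6) (# 7) (# 8)
    aₜ bₜ lhsₜ rhsₜ : Lₜ
    aₜ = matₜ (# 9) (# 10) (# 11) (# 12)
    bₜ = matₜ (# 13) (# 14) (# 15) (# 16)
    lhsₜ = alternatingₜ Nₜ aₜ bₜ
    rhsₜ = trₜ (Nₜ f0 ∘ₜ Nₜ f1 ∘ₜ Nₜ f2) ·ₜ (aₜ ∘ₜ bₜ +ₜ (⊝ (trₜ aₜ ⊗ trₜ bₜ)) ·ₜ idₜ)
    at : ∀ i j → NormalFormsAgree ρ (lhsₜ i j) (rhsₜ i j) → ⟦ lhsₜ i j ⟧ₜ ρ ≈ ⟦ rhsₜ i j ⟧ₜ ρ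
    at i j = prove ρ (lhsₜ i j) (rhsₜ i j)

  alternating-traceless : (N : Fin 3 → L) (a b : L) → (∀ i → tr (N i) ≈ 0#) →
    alternating N a b ≈L tr (N f0 ∘L N f1 ∘L N f2) ·L (a ∘L b +L (- (tr a * tr b)) ·L idL)
  alternating-traceless N a b trN≈0 i j = begin
    alternating N a b i j                   ≈⟨ alternating-cong N≈N′ a b i j ⟩
    alternating N′ a b i j                  ≈⟨ alternating-tracelessForm N a b i j ⟩
    tr (N′ f0 ∘L N′ f1 ∘L N′ f2) * r i j    ≈⟨ *-congʳ (tr-cong (∘L-cong (∘L-cong (N≈N′ f0) (N≈N′ f1)) (N≈N′ f2))) ⟨
    tr (N f0 ∘L N f1 ∘L N f2) * r i j       ∎
    where
    N′ : Fin 3 → L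
    N′ k = tracelessForm (N k)
    N≈N′ : ∀ k → N k ≈L N′ k
    N≈N′ k = traceless⇒≈tracelessForm (N k) (trN≈0 k)
    r : L
    r = a ∘L b +L (- (tr a * tr b)) ·L idL

  tr-cmap : (v : Fin 3 → Vec2) (lam : Fin 3 → Dual2) (i : Fin 3) →
            tr (cmap v lam i i) ≈ ev (lam i) (v i)
  tr-cmap v lam i = +-cong (*-comm _ _) (*-comm _ _)

  tr-cmap-chain : (v : Fin 3 → Vec2) (lam : Fin 3 → Dual2) (i j k : Fin 3) →
    tr (cmap v lam i i ∘L cmap v lam j j ∘L cmap v lam k k)
      ≈ ev (lam i) (v j) * ev (lam j) (v k) * ev (lam k) (v i)
  tr-cmap-chain v lam i j k = prove ρ
      (trₜ (outerₜ xᵢ ξᵢ ∘ₜ outerₜ xⱼ ξⱼ ∘ₜ outerₜ xₖ ξₖ))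
      (evₜ ξᵢ xⱼ ⊗ evₜ ξⱼ xₖ ⊗ evₜ ξₖ xᵢ) refl
    where
    open Symbolic {12}
    ρ : Vec Carrier 12
    ρ = components (v i) ++ components (v j) ++ components (v k)
        ++ components (lam i) ++ components (lam j) ++ components (lam k)
    xᵢ xⱼ xₖ ξᵢ ξⱼ ξₖ : Fin 2 → Term 12
    xᵢ = vecₜ (# 0) (# 1)
    xⱼ = vecₜ (# 2) (# 3)
    xₖ = vecₜ (# 4) (# 5)
    ξᵢ = vecₜ (# 6) (# 7)
    ξⱼ = vecₜ (# 8) (# 9)
    ξₖ = vecₜ (# 10) (# 11)

  cmap-chain : (v : Fin 3 → Vec2) (lam : Fin 3 → Dual2) (i j k : Fin 3) (a b : L) →
    cmap v lam k k ∘L b ∘L cmap v lam j j ∘L a ∘L cmap v lam i i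
      ≈L (tr (a ∘L cmap v lam i j) * tr (b ∘L cmap v lam j k)) ·L cmap v lam k i
  cmap-chain v lam i j k a b =
    byEntries (at fz fz refl) (at fz (fs fz) refl) (at (fs fz) fz refl) (at (fs fz) (fs fz) refl)
    where
    open Symbolic {20}
    ρ : Vec Carrier 20
    ρ = components (v i) ++ components (v j) ++ components (v k)
        ++ components (lam i) ++ components (lam j) ++ components (lam k)
        ++ entries a ++ entries b
    xᵢ xⱼ xₖ ξᵢ ξⱼ ξₖ : Fin 2 → Term 20
    xᵢ = vecₜ (# 0) (# 1)
    xⱼ = vecₜ (# 2) (# 3)
    xₖ = vecₜ (# 4) (# 5)
    ξᵢ = vecₜ (# 6) (# 7)
    ξⱼ = vecₜ (# 8) (# 9)
    ξₖ = vecₜ (# 10) (# 11)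
    aₜ bₜ lhsₜ rhsₜ : Lₜ
    aₜ = matₜ (# 12) (# 13) (# 14) (# 15)
    bₜ = matₜ (# 16) (# 17) (# 18) (# 19)
    lhsₜ = outerₜ xₖ ξₖ ∘ₜ bₜ ∘ₜ outerₜ xⱼ ξⱼ ∘ₜ aₜ ∘ₜ outerₜ xᵢ ξᵢ
    rhsₜ = trₜ (aₜ ∘ₜ outerₜ xᵢ ξⱼ) ⊗ trₜ (bₜ ∘ₜ outerₜ xⱼ ξₖ) ·ₜ outerₜ xₖ ξᵢ
    at : ∀ r s → NormalFormsAgree ρ (lhsₜ r s) (rhsₜ r s) → ⟦ lhsₜ r s ⟧ₜ ρ ≈ ⟦ rhsₜ r s ⟧ₜ ρ
    at r s = prove ρ (lhsₜ r s) (rhsₜ r s)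

  sumS3-cmap : (v : Fin 3 → Vec2) (lam : Fin 3 → Dual2) (a₁ a₂ : L) →
    sumS3 (λ σ → let open Perm3 σ in
             (ε sgn * tr (a₁ ∘L cmap v lam s1 s2) * tr (a₂ ∘L cmap v lam s2 s3)) ·L cmap v lam s3 s1)
      ≈L alternating (λ i → cmap v lam i i) a₁ a₂
  sumS3-cmap v lam a₁ a₂ = sumS3-cong λ σ → let open Perm3 σ in λ r s →
    let t₁ = tr (a₁ ∘L cmap v lam s1 s2)
        t₂ = tr (a₂ ∘L cmap v lam s2 s3)
        x  = cmap v lam s3 s1 r s
    in begin
      ε sgn * t₁ * t₂ * x       ≈⟨ *-assoc _ _ _ ⟩
      ε sgn * t₁ * (t₂ * x)     ≈⟨ *-assoc _ _ _ ⟩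
      ε sgn * (t₁ * (t₂ * x))   ≈⟨ *-congˡ (*-assoc _ _ _) ⟨
      ε sgn * (t₁ * t₂ * x)     ≈⟨ *-congˡ (cmap-chain v lam s1 s2 s3 a₁ a₂ r s) ⟨
      ε sgn * (cmap v lam s3 s3 ∘L a₂ ∘L cmap v lam s2 s2 ∘L a₁ ∘L cmap v lam s1 s1) r s ∎

  isolate : ∀ {D inv x y w δ} → D * inv ≈ 1# → y ≈ D * (x + - w * δ) → x ≈ w * δ + inv * y
  isolate {D} {inv} {x} {y} {w} {δ} D*inv≈1 y≈ = begin
    x                                ≈⟨ prove (w ∷ δ ∷ x ∷ []) xₜ (wₜ ⊗ δₜ ⊕ (xₜ ⊕ ⊝ wₜ ⊗ δₜ)) refl ⟩
    w * δ + (x + - w * δ)            ≈⟨ +-congˡ (*-identityˡ _) ⟨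
    w * δ + 1# * (x + - w * δ)       ≈⟨ +-congˡ (*-congʳ D*inv≈1) ⟨
    w * δ + D * inv * (x + - w * δ)  ≈⟨ +-congˡ (*-congʳ (*-comm D inv)) ⟩
    w * δ + inv * D * (x + - w * δ)  ≈⟨ +-congˡ (*-assoc inv D _) ⟩
    w * δ + inv * (D * (x + - w * δ)) ≈⟨ +-congˡ (*-congˡ y≈) ⟨
    w * δ + inv * y                  ∎
    where
    wₜ δₜ xₜ : Term 3
    wₜ = ι (# 0)
    δₜ = ι (# 1)
    xₜ = ι (# 2)

corollary5p2 : ∀ {c ℓ} (F : Field c ℓ) →
  let open Field F
      open LinAlg2 F
      open Sum3 F
  in (v : Fin 3 → Vec2) (lam : Fin 3 → Dual2) →
     (∀ i → ¬ (v i ≈V zeroV)) →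
     (∀ i j → i ≢ j → ¬ Colinear (v i) (v j)) →
     (∀ i → ¬ (lam i ≈V zeroD)) →
     (∀ i → ev (lam i) (v i) ≈ 0#) →
     (inv : Carrier) →
     (ev (lam f0) (v f1) * ev (lam f1) (v f2) * ev (lam f2) (v f0)) * inv ≈ 1# →
     (a₁ a₂ : L) →
     (a₁ ∘L a₂) ≈L
       ((tr a₁ * tr a₂) ·L idL
         +L (inv ·L sumS3 (λ σ →
               let open Perm3 σ in
               (ε sgn * tr (a₁ ∘L cmap v lam s1 s2) * tr (a₂ ∘L cmap v lam s2 s3))
                 ·L cmap v lam s3 s1)))
corollary5p2 F v lam _ _ _ λᵢvᵢ≈0 inv D*inv≈1 a₁ a₂ r s =
  isolate D*inv≈1
    (trans (sumS3-cmap v lam a₁ a₂ r s)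
    (trans (alternating-traceless cᵢᵢ a₁ a₂ trcᵢᵢ≈0 r s)
           (*-congʳ (tr-cmap-chain v lam f0 f1 f2))))
  where
  open Field F
  open LinAlg2 F
  open TwoByTwo F
  cᵢᵢ : Fin 3 → L
  cᵢᵢ i = cmap v lam i i
  trcᵢᵢ≈0 : ∀ i → tr (cᵢᵢ i) ≈ 0#
  trcᵢᵢ≈0 i = trans (tr-cmap v lam i) (λᵢvᵢ≈0 i)
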